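{- Let $\mathbf A$ be an $\mathcal I$-zroupoid satisfying $x'' \approx x$ and $(x \to y)' \approx x \to (0 \to y)$. Then $\mathbf A$ satisfies $[x \to (y \to z)']' \approx x \to \big((y \to (0 \to z))'\big)$.
   Context: An $\mathcal I$-zroupoid is an algebra $\langle A,\to,0\rangle$ ($\to$ binary, $0$ constant) satisfying $(x \to y) \to z \approx [(z' \to x) \to (y \to z)']'$ and $0''\approx 0$, where $x' := x \to 0$ (prime binds tighter than $\to$; a prime after a parenthesized term applies to that whole term). -}

module Defs where

open import Level using (Level; suc)
open import Relation.Binary.PropositionalEquality using (_≡_)

record IZroupoid (a : Level) : Set (suc a) where
  infixr 5 _⇒_
  field
    Carrier : Set a
    _⇒_     : Carrier → Carrier → Carrier
    𝟘       : Carrier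

  _′ : Carrier → Carrier
  x ′ = x ⇒ 𝟘

  field
    axiom-I : ∀ x y z → ((x ⇒ y) ⇒ z) ≡ ((((z ′) ⇒ x) ⇒ ((y ⇒ z) ′)) ′)
    axiom-0 : ((𝟘 ′) ′) ≡ 𝟘

-- Under x'' ≈ x, the axiom instance (x → 0) → 0 = [(0' → x) → 0'']' shows that 1 := 0' is a
-- left unit. The second hypothesis at 1 then gives 0 → u' ≈ (1 → u')' ≈ u, i.e. 0 → _ inverts _′.
-- Both sides of the identity thus reduce to x → (y → z): on the left via the second hypothesis,
-- on the right because (y → (0 → z))' ≈ (y → z)'' ≈ y → z.
module Submission where

open import Defs
open import Level using (Level)
open import Relation.Binary.PropositionalEquality using (_≡_; sym; cong; module ≡-Reasoning)

module _ {a : Level} (A : IZroupoid a) where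
  open IZroupoid A
  open ≡-Reasoning

  module _ (′-involutive : ∀ x → ((x ′) ′) ≡ x) where

    𝟘′-identityˡ : ∀ x → ((𝟘 ′) ⇒ x) ≡ x
    𝟘′-identityˡ x = begin
      (𝟘 ′) ⇒ x                                 ≡⟨ sym (′-involutive _) ⟩
      ((((𝟘 ′) ⇒ x) ⇒ 𝟘) ′)                     ≡⟨ cong (λ t → (((𝟘 ′) ⇒ x) ⇒ t) ′) (sym axiom-0) ⟩
      ((((𝟘 ′) ⇒ x) ⇒ ((𝟘 ⇒ 𝟘) ′)) ′)           ≡⟨ sym (axiom-I x 𝟘 𝟘) ⟩
      ((x ′) ′)                                 ≡⟨ ′-involutive x ⟩
      x                                         ∎

    module _ (′-⇒ : ∀ x y → ((x ⇒ y) ′) ≡ (x ⇒ (𝟘 ⇒ y))) where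

      𝟘⇒-′ : ∀ x → (𝟘 ⇒ (x ′)) ≡ x
      𝟘⇒-′ x = begin
        𝟘 ⇒ (x ′)                ≡⟨ sym (𝟘′-identityˡ _) ⟩
        (𝟘 ′) ⇒ (𝟘 ⇒ (x ′))      ≡⟨ sym (′-⇒ (𝟘 ′) (x ′)) ⟩
        (((𝟘 ′) ⇒ (x ′)) ′)      ≡⟨ cong _′ (𝟘′-identityˡ (x ′)) ⟩
        ((x ′) ′)                ≡⟨ ′-involutive x ⟩
        x                        ∎

      ⇒𝟘⇒-′ : ∀ x y → ((x ⇒ (𝟘 ⇒ y)) ′) ≡ (x ⇒ y)
      ⇒𝟘⇒-′ x y = begin
        ((x ⇒ (𝟘 ⇒ y)) ′)   ≡⟨ cong _′ (sym (′-⇒ x y)) ⟩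
        (((x ⇒ y) ′) ′)     ≡⟨ ′-involutive (x ⇒ y) ⟩
        x ⇒ y               ∎

lemma3p3 : ∀ {a : Level} (A : IZroupoid a) → let open IZroupoid A in
    (∀ x → ((x ′) ′) ≡ x) →
    (∀ x y → ((x ⇒ y) ′) ≡ (x ⇒ (𝟘 ⇒ y))) →
    ∀ x y z → ((x ⇒ ((y ⇒ z) ′)) ′) ≡ (x ⇒ ((y ⇒ (𝟘 ⇒ z)) ′))
lemma3p3 A ′-involutive ′-⇒ x y z = begin
  ((x ⇒ ((y ⇒ z) ′)) ′)          ≡⟨ ′-⇒ x ((y ⇒ z) ′) ⟩
  x ⇒ (𝟘 ⇒ ((y ⇒ z) ′))          ≡⟨ cong (x ⇒_) (𝟘⇒-′ A ′-involutive ′-⇒ (y ⇒ z)) ⟩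
  x ⇒ (y ⇒ z)                    ≡⟨ cong (x ⇒_) (sym (⇒𝟘⇒-′ A ′-involutive ′-⇒ y z)) ⟩
  x ⇒ ((y ⇒ (𝟘 ⇒ z)) ′)          ∎
  where
  open IZroupoid A
  open ≡-Reasoning
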